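{- Let $4\le q<\omega$ and let $\mathfrak A$ be a Monk algebra obtained from $\mathfrak E^{23}_q$ by splitting (so $\mathfrak E^{23}_q\subseteq\mathfrak A$). Then $\mathfrak A$ is a special extension of every subalgebra $\mathfrak E$ of $\mathfrak E^{23}_q$.
   Context: All relation algebras here are symmetric ($\breve x=x$ for all $x$) and integral ($1'$ is an atom); $0'$ denotes the diversity element $\overline{1'}$, $;$ the relative product, $\overline{x}$ Boolean complement. For $4\le q<\omega$, $\mathfrak E^{23}_q$ is the finite symmetric integral relation algebra with $q$ atoms $e_0=1',e_1,\dots,e_{q-1}$ such that for distinct diversity atoms $a,b$ we have $a;b=0'$, and $a;a=\overline a$ for every diversity atom $a$. If $\mathfrak A,\mathfrak B$ are atomic relation algebras, $\mathfrak A$ is obtained from $\mathfrak B$ by splitting if $\mathfrak B\subseteq\mathfrak A$, every atom $x$ of $\mathfrak A$ is below an atom $c(x)$ of $\mathfrak B$, and for all atoms $x,y\le 0'$ of $\mathfrak A$: $x;y=c(x);c(y)\cdot 0'$ if $x\ne\breve y$, and $x;y=c(x);c(y)$ if $x=\breve y$. A Monk algebra is an atomic symmetric integral relation algebra obtained by splitting from some $\mathfrak E^{23}_q$, $4\le q<\omega$. If $\mathfrak A,\mathfrak E$ are finite symmetric integral relation algebras, $\mathfrak A$ is a special extension of $\mathfrak E$ if $\mathfrak E\subseteq\mathfrak A$ and for all diversity atoms $a,b,c$ of $\mathfrak E$: (1) if not $a=b=c$ and $a;b\ge c$, then $x;y\ge c$ for all atoms $x\le a$, $y\le b$ of $\mathfrak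 A$; (2) if $a;a\ge a$, then $x;y\cdot a\ne0$ for all atoms $x,y\le a$ of $\mathfrak A$. -}

module Defs where

open import Data.Nat using (ℕ; zero; suc)
open import Data.Bool using (Bool; true; false; _∧_; _∨_; not)
open import Data.Fin using (Fin; zero; suc; _≟_)
open import Data.Product using (Σ; _×_; ∃)
open import Relation.Nullary using (¬_; does)
open import Relation.Binary.PropositionalEquality using (_≡_; _≢_)

-- Finite symmetric integral relation algebras, presented (as usual) as
-- the complex algebra of their atom structure.
-- An algebra with n diversity atoms has atoms  Fin (suc n);  the atom
-- `zero` is the identity atom 1'.
-- T a b c ≡ true  means  c ≤ a ; b  (for atoms a b c).

Table : ℕ → Set
Table n = Fin (suc n) → Fin (suc n) → Fin (suc n) → Bool

Elem : ℕ → Set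
Elem n = Fin (suc n) → Bool

anyF : ∀ {k} → (Fin k → Bool) → Bool
anyF {zero}  f = false
anyF {suc k} f = f zero ∨ anyF (λ i → f (suc i))

eqF : ∀ {k} → Fin k → Fin k → Bool
eqF a b = does (a ≟ b)

_⊕_ : ∀ {n} → Elem n → Elem n → Elem n
(X ⊕ Y) z = X z ∨ Y z

_⊗_ : ∀ {n} → Elem n → Elem n → Elem n
(X ⊗ Y) z = X z ∧ Y z

∁ : ∀ {n} → Elem n → Elem n
∁ X z = not (X z)

one' : ∀ {n} → Elem n
one' z = eqF z zero

zero' : ∀ {n} → Elem n
zero' = ∁ one'

-- relative product in the complex algebra (converse is the identity map)
comp : ∀ {n} → Table n → Elem n → Elem n → Elem n
comp T X Y z = anyF (λ a → anyF (λ b → X a ∧ (Y b ∧ T a b z)))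

atom : ∀ {n} → Fin (suc n) → Elem n
atom a z = eqF a z

_≤ₑ_ : ∀ {n} → Elem n → Elem n → Set
X ≤ₑ Y = ∀ z → X z ≡ true → Y z ≡ true

_≐_ : ∀ {n} → Elem n → Elem n → Set
X ≐ Y = ∀ z → X z ≡ Y z

Nonzero : ∀ {n} → Elem n → Set
Nonzero X = ∃ λ z → X z ≡ true

record IsSIRA {n : ℕ} (T : Table n) : Set where
  field
    identity : ∀ a c → T zero a c ≡ eqF a c
    peirce₁  : ∀ a b c → T a b c ≡ T a c b
    peirce₂  : ∀ a b c → T a b c ≡ T c b a
    assoc    : ∀ a b c d →
               anyF (λ e → T a b e ∧ T e c d) ≡ anyF (λ f → T b c f ∧ T a f d)

record IsEmbedding {m n : ℕ} (TB : Table m) (TA : Table n)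
                   (g : Elem m → Elem n) : Set where
  field
    g-cong  : ∀ X Y → X ≐ Y → g X ≐ g Y
    g-inj   : ∀ X Y → g X ≐ g Y → X ≐ Y
    g-join  : ∀ X Y → g (X ⊕ Y) ≐ (g X ⊕ g Y)
    g-compl : ∀ X → g (∁ X) ≐ ∁ (g X)
    g-one'  : g one' ≐ one'
    g-comp  : ∀ X Y → g (comp TB X Y) ≐ comp TA (g X) (g Y)

-- A (table TA) is obtained from B (table TB) by splitting, B ⊆ A via g.
-- c x is the B-atom above the A-atom x.  (x ≠ y˘ iff x ≠ y, as ˘ is trivial.)
Splitting : {m n : ℕ} (TB : Table m) (TA : Table n) (g : Elem m → Elem n) → Set
Splitting {m} {n} TB TA g =
  IsEmbedding TB TA g ×
  Σ (Fin (suc n) → Fin (suc m)) λ c →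
    (∀ x → atom x ≤ₑ g (atom (c x))) ×
    (∀ (x y : Fin (suc n)) → x ≢ zero → y ≢ zero →
       (x ≢ y → comp TA (atom x) (atom y)
                  ≐ (comp TA (g (atom (c x))) (g (atom (c y))) ⊗ zero')) ×
       (x ≡ y → comp TA (atom x) (atom y)
                  ≐ comp TA (g (atom (c x))) (g (atom (c y)))))

E23 : (q : ℕ) → Table (q Data.Nat.∸ 1)
E23 q zero b c = eqF b c
E23 q (suc a) zero c = eqF (suc a) c
E23 q (suc a) (suc b) c with does (a ≟ b)
... | true  = not (eqF (suc a) c)
... | false = not (eqF c zero)

SpecialExt : {m n : ℕ} (TE : Table m) (TA : Table n) (g : Elem m → Elem n) → Set
SpecialExt {m} {n} TE TA g =
  IsEmbedding TE TA g ×
  ((a b c : Fin (suc m)) → a ≢ zero → b ≢ zero → c ≢ zero →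
     (¬ (a ≡ b × b ≡ c) → atom c ≤ₑ comp TE (atom a) (atom b) →
        ∀ (x y : Fin (suc n)) → atom x ≤ₑ g (atom a) → atom y ≤ₑ g (atom b) →
          g (atom c) ≤ₑ comp TA (atom x) (atom y)) ×
     (atom a ≤ₑ comp TE (atom a) (atom a) →
        ∀ (x y : Fin (suc n)) → atom x ≤ₑ g (atom a) → atom y ≤ₑ g (atom a) →
          Nonzero (comp TA (atom x) (atom y) ⊗ g (atom a))))

module Submission where

-- In E^{23}_q every triple (e, f, w) of diversity atoms is a consistent cycle,
-- w ≤ e ; f, unless e = f = w.  Splitting only refines atoms, so for atoms
-- x, y ≤ 0' of A and a diversity atom w of E^{23}_q we get w ≤ x ; y as soon
-- as not c(x) = c(y) = w.  Subalgebra atoms are disjoint, which rules out this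
-- bad case in condition (1) — so there c ≤ a.

open import Defs
open import Data.Nat using (ℕ; zero; suc; _≤_; _∸_)
open import Data.Bool using (Bool; true; false; _∧_; _∨_; not) renaming (_≟_ to _≟ᵇ_)
open import Data.Bool.Properties using (∨-inverseʳ; ¬-not)
open import Data.Fin using (Fin; zero; suc; _≟_)
open import Data.Fin.Properties using (any?)
open import Data.Product using (_×_; ∃; _,_; proj₁; proj₂)
open import Function using (_∘_)
open import Relation.Nullary using (¬_; yes; no; contradiction)
open import Relation.Nullary.Decidable using (dec-true; dec-false)
open import Relation.Binary.PropositionalEquality

∧-true : ∀ {a b} → a ∧ b ≡ true → a ≡ true × b ≡ true
∧-true {true} b≡true = refl , b≡true

anyF-intro : ∀ {k} (f : Fin k → Bool) i → f i ≡ true → anyF f ≡ true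
anyF-intro f zero    fi≡true rewrite fi≡true = refl
anyF-intro f (suc i) fi≡true with f zero
... | true  = refl
... | false = anyF-intro (f ∘ suc) i fi≡true

anyF-elim : ∀ {k} (f : Fin k → Bool) → anyF f ≡ true → ∃ λ i → f i ≡ true
anyF-elim {zero}  f ()
anyF-elim {suc k} f any≡true with f zero in f0≡true
... | true  = zero , f0≡true
... | false with anyF-elim (f ∘ suc) any≡true
...   | i , fi≡true = suc i , fi≡true

eqF-refl : ∀ {k} (a : Fin k) → eqF a a ≡ true
eqF-refl a = dec-true (a ≟ a) refl

eqF-true : ∀ {k} {a b : Fin k} → eqF a b ≡ true → a ≡ b
eqF-true {a = a} {b} eq with a ≟ b
... | yes a≡b = a≡b

eqF-false : ∀ {k} {a b : Fin k} → a ≢ b → eqF a b ≡ false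
eqF-false {a = a} {b} = dec-false (a ≟ b)

atom-≤ : ∀ {n} {X : Elem n} {a} → X a ≡ true → atom a ≤ₑ X
atom-≤ {X = X} Xa z a≡z = subst (λ w → X w ≡ true) (eqF-true a≡z) Xa

atom-∈ : ∀ {n} {X : Elem n} a → atom a ≤ₑ X → X a ≡ true
atom-∈ a a≤X = a≤X a (eqF-refl a)

atom-≤-∁ : ∀ {n} {X : Elem n} {a} → X a ≡ false → atom a ≤ₑ ∁ X
atom-≤-∁ Xa≡false = atom-≤ (cong not Xa≡false)

∁-∉ : ∀ {n} {X : Elem n} {z} → ∁ X z ≡ true → X z ≢ true
∁-∉ ∁Xz Xz = contradiction (trans (cong not (sym Xz)) ∁Xz) λ ()

∅ₑ : ∀ {n} → Elem n
∅ₑ _ = false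

atom-zero≐one' : ∀ {n} → atom {n} zero ≐ one'
atom-zero≐one' zero    = refl
atom-zero≐one' (suc z) = refl

diversity⁺ : ∀ {n} {w : Fin (suc n)} → w ≢ zero → zero' w ≡ true
diversity⁺ w≢0 = cong not (eqF-false w≢0)

diversity⁻ : ∀ {n} {w : Fin (suc n)} → zero' w ≡ true → w ≢ zero
diversity⁻ () refl

atom-≤-zero' : ∀ {n} {a : Fin (suc n)} → a ≢ zero → atom a ≤ₑ zero'
atom-≤-zero' {a = a} a≢0 = atom-≤ {X = zero'} {a} (diversity⁺ a≢0)

comp-intro : ∀ {n} {T : Table n} {X Y : Elem n} {a b z} →
  X a ≡ true → Y b ≡ true → T a b z ≡ true → comp T X Y z ≡ true
comp-intro {T = T} {X} {Y} {a} {b} {z} Xa Yb Tabz =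
  anyF-intro (λ a′ → anyF (λ b′ → X a′ ∧ (Y b′ ∧ T a′ b′ z))) a
    (anyF-intro (λ b′ → X a ∧ (Y b′ ∧ T a b′ z)) b (cong₂ _∧_ Xa (cong₂ _∧_ Yb Tabz)))

comp-elim : ∀ {n} {T : Table n} {X Y : Elem n} {z} → comp T X Y z ≡ true →
  ∃ λ a → ∃ λ b → X a ≡ true × Y b ≡ true × T a b z ≡ true
comp-elim comp≡true with anyF-elim _ comp≡true
... | a , any≡true with anyF-elim _ any≡true
...   | b , conj with ∧-true conj
...     | Xa , conj′ with ∧-true conj′
...       | Yb , Tabz = a , b , Xa , Yb , Tabz

module EmbeddingProperties {m n} {TB : Table m} {TA : Table n} {g : Elem m → Elem n}
                           (emb : IsEmbedding TB TA g) where
  open IsEmbedding emb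

  g-mono : ∀ {X Y} → X ≤ₑ Y → g X ≤ₑ g Y
  g-mono {X} {Y} X≤Y z gXz = begin
    g Y z         ≡⟨ g-cong Y (X ⊕ Y) Y≐X⊕Y z ⟩
    g (X ⊕ Y) z   ≡⟨ g-join X Y z ⟩
    g X z ∨ g Y z ≡⟨ cong (_∨ g Y z) gXz ⟩
    true          ∎
    where
    open ≡-Reasoning
    Y≐X⊕Y : Y ≐ (X ⊕ Y)
    Y≐X⊕Y w with X w in Xw
    ... | true  = X≤Y w Xw
    ... | false = refl

  g-mono-∁ : ∀ {X Y} → X ≤ₑ ∁ Y → g X ≤ₑ ∁ (g Y)
  g-mono-∁ {Y = Y} X≤∁Y z gXz = trans (sym (g-compl Y z)) (g-mono X≤∁Y z gXz)

  g-empty : ∀ z → g ∅ₑ z ≡ false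
  g-empty z = begin
    g ∅ₑ z                             ≡⟨ g-cong ∅ₑ (∁ (∅ₑ ⊕ ∁ ∅ₑ)) (λ _ → refl) z ⟩
    g (∁ (∅ₑ ⊕ ∁ ∅ₑ)) z                ≡⟨ g-compl (∅ₑ ⊕ ∁ ∅ₑ) z ⟩
    not (g (∅ₑ ⊕ ∁ ∅ₑ) z)              ≡⟨ cong not (g-join ∅ₑ (∁ ∅ₑ) z) ⟩
    not (g ∅ₑ z ∨ g (∁ ∅ₑ) z)          ≡⟨ cong (λ t → not (g ∅ₑ z ∨ t)) (g-compl ∅ₑ z) ⟩
    not (g ∅ₑ z ∨ not (g ∅ₑ z))        ≡⟨ cong not (∨-inverseʳ (g ∅ₑ z)) ⟩
    false                              ∎
    where open ≡-Reasoning

  g-nonzero : ∀ {X} → Nonzero X → Nonzero (g X)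
  g-nonzero {X} (a , Xa) with any? (λ z → g X z ≟ᵇ true)
  ... | yes nonzero = nonzero
  ... | no  empty   = contradiction (trans (sym Xa) (g-inj X ∅ₑ gX≐∅ a)) λ ()
    where
    gX≐∅ : g X ≐ g ∅ₑ
    gX≐∅ z = trans (¬-not λ gXz → empty (z , gXz)) (sym (g-empty z))

  g-diversity : ∀ {X} → X ≤ₑ zero' → g X ≤ₑ zero'
  g-diversity X≤0' z gXz = trans (cong not (sym (g-one' z))) (g-mono-∁ X≤0' z gXz)

  g-atom-diversity : ∀ {a z} → a ≢ zero → g (atom a) z ≡ true → z ≢ zero
  g-atom-diversity {z = z} a≢0 gaz = diversity⁻ (g-diversity (atom-≤-zero' a≢0) z gaz)

  g-atom-injective : ∀ {a b w} → g (atom a) w ≡ true → g (atom b) w ≡ true → a ≡ b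
  g-atom-injective {a} {b} {w} gaw gbw with a ≟ b
  ... | yes a≡b = a≡b
  ... | no  a≢b = contradiction gbw (∁-∉ {X = g (atom b)} (g-mono-∁ (atom-≤-∁ (eqF-false (a≢b ∘ sym))) w gaw))

∘-isEmbedding : ∀ {l m n} {TE : Table l} {TB : Table m} {TA : Table n}
                  {k : Elem l → Elem m} {h : Elem m → Elem n} →
                IsEmbedding TE TB k → IsEmbedding TB TA h → IsEmbedding TE TA (h ∘ k)
∘-isEmbedding {k = k} K H = record
  { g-cong  = λ X Y X≐Y → H.g-cong (k X) (k Y) (K.g-cong X Y X≐Y)
  ; g-inj   = λ X Y hkX≐hkY → K.g-inj X Y (H.g-inj (k X) (k Y) hkX≐hkY)
  ; g-join  = λ X Y z → trans (H.g-cong _ _ (K.g-join X Y) z) (H.g-join (k X) (k Y) z)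
  ; g-compl = λ X z → trans (H.g-cong _ _ (K.g-compl X) z) (H.g-compl (k X) z)
  ; g-one'  = λ z → trans (H.g-cong _ _ K.g-one' z) (H.g-one' z)
  ; g-comp  = λ X Y z → trans (H.g-cong _ _ (K.g-comp X Y) z) (H.g-comp (k X) (k Y) z)
  }
  where
  module K = IsEmbedding K
  module H = IsEmbedding H

module SplittingProperties {m n} {TB : Table m} {TA : Table n} {h : Elem m → Elem n}
                           (split : Splitting TB TA h) where
  open IsEmbedding (proj₁ split)
  open EmbeddingProperties (proj₁ split) public

  c : Fin (suc n) → Fin (suc m)
  c = proj₁ (proj₂ split)

  x≤hc : ∀ x → atom x ≤ₑ h (atom (c x))
  x≤hc = proj₁ (proj₂ (proj₂ split))

  private
    x∙y-split = proj₂ (proj₂ (proj₂ split))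

  c-cover : ∀ {X x} → atom x ≤ₑ h X → X (c x) ≡ true
  c-cover {X} {x} x≤hX with X (c x) in Xcx
  ... | true  = refl
  ... | false = contradiction (atom-∈ x x≤hX) (∁-∉ {X = h X} (g-mono-∁ (atom-≤-∁ Xcx) x (atom-∈ x (x≤hc x))))

  c-diversity : ∀ {x} → x ≢ zero → c x ≢ zero
  c-diversity {x} x≢0 cx≡0 = x≢0 (eqF-true (begin
    eqF x zero           ≡⟨ sym (g-one' x) ⟩
    h one' x             ≡⟨ g-cong _ _ atom-zero≐one' x ⟨
    h (atom zero) x      ≡⟨ cong (λ a → h (atom a) x) cx≡0 ⟨
    h (atom (c x)) x     ≡⟨ atom-∈ x (x≤hc x) ⟩
    true                 ∎))
    where open ≡-Reasoning

  split-comp : ∀ {x y z} → x ≢ zero → y ≢ zero → z ≢ zero →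
    h (comp TB (atom (c x)) (atom (c y))) z ≡ true → comp TA (atom x) (atom y) z ≡ true
  split-comp {x} {y} {z} x≢0 y≢0 z≢0 hcxcy with x ≟ y | x∙y-split x y x≢0 y≢0
  ... | yes x≡y | _ , equal  = trans (equal x≡y z) (trans (sym (g-comp _ _ z)) hcxcy)
  ... | no  x≢y | distinct , _ =
    trans (distinct x≢y z) (cong₂ _∧_ (trans (sym (g-comp _ _ z)) hcxcy) (diversity⁺ z≢0))

E23-cycle : ∀ q {e f w : Fin (suc (q ∸ 1))} → e ≢ zero → f ≢ zero → w ≢ zero →
  ¬ (e ≡ w × f ≡ w) → E23 q e f w ≡ true
E23-cycle q {zero}  e≢0 _ _ _ = contradiction refl e≢0
E23-cycle q {suc e} {zero} _ f≢0 _ _ = contradiction refl f≢0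
E23-cycle q {suc e} {suc f} {zero} _ _ w≢0 _ = contradiction refl w≢0
E23-cycle q {suc e} {suc f} {suc w} _ _ _ ¬e≡w×f≡w with e ≟ f
... | yes refl = cong not (eqF-false λ e≡w → ¬e≡w×f≡w (e≡w , e≡w))
... | no  _    = refl

E23-irreflexive : ∀ q {e : Fin (suc (q ∸ 1))} → e ≢ zero → E23 q e e e ≡ false
E23-irreflexive q {zero}  e≢0 = contradiction refl e≢0
E23-irreflexive q {suc e} _ with e ≟ e
... | yes _   = cong not (eqF-refl (suc e))
... | no  e≢e = contradiction refl e≢e

E23-square-other-atom : ∀ q {X : Elem (q ∸ 1)} {w} → w ≢ zero →
  comp (E23 q) X X w ≡ true → ∃ λ e → X e ≡ true × e ≢ w
E23-square-other-atom q {X} {w} w≢0 XXw with comp-elim {T = E23 q} {X} {X} XXw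
... | e , f , Xe , Xf , Tefw with e ≟ w
...   | no  e≢w = e , Xe , e≢w
...   | yes refl with f ≟ e
...     | no  f≢w = f , Xf , f≢w
...     | yes refl = contradiction (trans (sym Tefw) (E23-irreflexive q w≢0)) λ ()

module E23SplittingProperties (q : ℕ) {n} {TA : Table n} {h : Elem (q ∸ 1) → Elem n}
                              (split : Splitting (E23 q) TA h) where
  open SplittingProperties split public

  h-≤-product : ∀ {W} x y → x ≢ zero → y ≢ zero → W ≤ₑ zero' →
    (∀ w → W w ≡ true → ¬ (c x ≡ w × c y ≡ w)) → h W ≤ₑ comp TA (atom x) (atom y)
  h-≤-product {W} x y x≢0 y≢0 W≤0' ¬cx≡w≡cy z hWz =
    split-comp x≢0 y≢0 (diversity⁻ (g-diversity W≤0' z hWz)) (g-mono W≤cx∙cy z hWz)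
    where
    W≤cx∙cy : W ≤ₑ comp (E23 q) (atom (c x)) (atom (c y))
    W≤cx∙cy w Ww = comp-intro {T = E23 q} {atom (c x)} {atom (c y)} (eqF-refl (c x)) (eqF-refl (c y))
      (E23-cycle q (c-diversity x≢0) (c-diversity y≢0) (diversity⁻ (W≤0' w Ww)) (¬cx≡w≡cy w Ww))

  module _ {m} {TE : Table m} {k : Elem m → Elem (q ∸ 1)} (embK : IsEmbedding TE (E23 q) k) where
    private
      hk : IsEmbedding TE TA (h ∘ k)
      hk = ∘-isEmbedding embK (proj₁ split)
      module K  = EmbeddingProperties embK
      module HK = EmbeddingProperties hk

    special-triangle : ∀ {a b d} → a ≢ zero → b ≢ zero → d ≢ zero → ¬ (a ≡ b × b ≡ d) →
      ∀ x y → atom x ≤ₑ h (k (atom a)) → atom y ≤ₑ h (k (atom b)) →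
      h (k (atom d)) ≤ₑ comp TA (atom x) (atom y)
    special-triangle {a} {b} {d} a≢0 b≢0 d≢0 ¬a≡b≡d x y x≤hka y≤hkb =
      h-≤-product x y (HK.g-atom-diversity a≢0 (atom-∈ x x≤hka)) (HK.g-atom-diversity b≢0 (atom-∈ y y≤hkb))
        (K.g-diversity (atom-≤-zero' d≢0)) ¬cx≡w≡cy
      where
      ¬cx≡w≡cy : ∀ w → k (atom d) w ≡ true → ¬ (c x ≡ w × c y ≡ w)
      ¬cx≡w≡cy w kdw (cx≡w , cy≡w) = ¬a≡b≡d (trans a≡d (sym b≡d) , b≡d)
        where
        a≡d : a ≡ d
        a≡d = K.g-atom-injective (subst (λ v → k (atom a) v ≡ true) cx≡w (c-cover x≤hka)) kdw
        b≡d : b ≡ d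
        b≡d = K.g-atom-injective (subst (λ v → k (atom b) v ≡ true) cy≡w (c-cover y≤hkb)) kdw

    special-diagonal : ∀ {a} → a ≢ zero → atom a ≤ₑ comp TE (atom a) (atom a) →
      ∀ x y → atom x ≤ₑ h (k (atom a)) → atom y ≤ₑ h (k (atom a)) →
      Nonzero (comp TA (atom x) (atom y) ⊗ h (k (atom a)))
    special-diagonal {a} a≢0 a≤a∙a x y x≤hka y≤hka =
      witness (E23-square-other-atom q (c-diversity x≢0) ka∙ka∋cx)
      where
      x≢0 : x ≢ zero
      x≢0 = HK.g-atom-diversity a≢0 (atom-∈ x x≤hka)
      y≢0 : y ≢ zero
      y≢0 = HK.g-atom-diversity a≢0 (atom-∈ y y≤hka)

      ka∙ka∋cx : comp (E23 q) (k (atom a)) (k (atom a)) (c x) ≡ true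
      ka∙ka∋cx = trans (sym (IsEmbedding.g-comp embK _ _ (c x))) (K.g-mono a≤a∙a (c x) (c-cover x≤hka))

      witness : (∃ λ e → k (atom a) e ≡ true × e ≢ c x) →
                Nonzero (comp TA (atom x) (atom y) ⊗ h (k (atom a)))
      witness (e , kae , e≢cx) with g-nonzero (e , eqF-refl e)
      ... | z , hez = z , cong₂ _∧_ (he≤x∙y z hez) (g-mono (atom-≤ kae) z hez)
        where
        he≤x∙y : h (atom e) ≤ₑ comp TA (atom x) (atom y)
        he≤x∙y = h-≤-product x y x≢0 y≢0 (atom-≤-zero' (K.g-atom-diversity a≢0 kae))
                   (λ w ew (cx≡w , _) → e≢cx (trans (eqF-true ew) (sym cx≡w)))

lemma1 : (q : ℕ) → 4 ≤ q →
    {n : ℕ} (TA : Table n) → IsSIRA TA →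
    (h : Elem (q ∸ 1) → Elem n) → Splitting (E23 q) TA h →
    {m : ℕ} (TE : Table m) → IsSIRA TE →
    (k : Elem m → Elem (q ∸ 1)) → IsEmbedding TE (E23 q) k →
    SpecialExt TE TA (h ∘ k)
lemma1 q _ TA _ h split TE _ k embK =
  ∘-isEmbedding embK (proj₁ split) ,
  λ a b d a≢0 b≢0 d≢0 →
    (λ ¬a≡b≡d _ → special-triangle embK a≢0 b≢0 d≢0 ¬a≡b≡d) , special-diagonal embK a≢0
  where open E23SplittingProperties q split
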